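{- Let $\mathcal{G}=((V,E),\lambda)$ be a temporal clique on $n$ nodes. Then $\mathcal{G}$ is a 1D-mobility temporal clique if and only if there exists an ordering of $V$ that excludes the four forbidden ordered temporal patterns, i.e. an ordering $v_1,\dots,v_n$ of $V$ such that for all indices $i<j<k$, the label $\lambda(v_iv_k)$ is the median of $\{\lambda(v_iv_j),\lambda(v_iv_k),\lambda(v_jv_k)\}$.
   Context: A temporal clique $\mathcal{G}=((V,E),\lambda)$ is a complete graph $(V,E)$ on $n$ nodes together with a labeling $\lambda:E\to\mathbb{N}$ giving each edge a single appearance time. The labels are pairwise distinct; up to order-preserving relabeling of times, the lifetime is $T=n(n-1)/2$ and exactly one edge appears at each time $t\in\{1,\dots,T\}$. Two temporal graphs are isomorphic if there is a bijection between their vertex sets mapping edges to edges with the same label. 1D-mobility model: $n$ agents (the nodes) lie on a line in an initial ordering $\pi$ (a sequence listing all agents). A 1D-mobility schedule from $\pi$ is a sequence $x=(x_1,\dots,x_T)$ of pairs of agents, where, setting $\pi_0=\pi$, each $x_t=\{u,v\}$ consists of two agents that are consecutive in $\pi_{t-1}$, and $\pi_t$ is obtained from $\pi_{t-1}$ by exchanging $u$ and $v$ (a crossing). The temporal graph $\mathcal{G}_{\pi,x}$ has vertex set the agents and an edge $uv$ with label $t$ whenever $x_t=uv$. A temporal clique is a 1D-mobility temporal clique if it is isomorphic to $\mathcal{G}_{\pi,x}$ for some ordering $\pi$ and some 1D-mobility schedule $x$ from $\pi$ such that $\mathcal{G}_{\pi,x}$ is a temporal clique (each pair of agents crosses exactly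 once). The four forbidden ordered patterns are the ordered triangles $a,b,c$ (ordered left to right) in which the edge $ac$ has the smallest label (two patterns, according to whether $\lambda(ab)<\lambda(bc)$ or not) or the largest label (two patterns); an ordering excludes them exactly when, for every three nodes appearing in the order $a,b,c$, $\lambda(ac)$ lies strictly between $\lambda(ab)$ and $\lambda(bc)$. -}

module Defs where

open import Data.Nat using (ℕ; suc; _*_; _∸_; _≤_; _<_)
open import Data.Nat.DivMod using (_/_)
open import Data.Fin using (Fin; toℕ) renaming (_<_ to _<ᶠ_)
open import Data.List using (List; []; _∷_; _++_; length; lookup; allFin)
open import Data.List.Relation.Binary.Permutation.Propositional using (_↭_)
open import Data.Product using (Σ; _×_; _,_; ∃-syntax)
open import Data.Sum using (_⊎_)
open import Function.Bundles using (_↔_; Inverse; _⇔_)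
open import Relation.Binary.PropositionalEquality using (_≡_; _≢_)

lifetime : ℕ → ℕ
lifetime n = (n * (n ∸ 1)) / 2

-- A temporal clique on the vertex set Fin n: a (symmetric) label for each
-- edge {u,v} (u ≢ v); labels pairwise distinct on distinct edges and, after
-- the order-preserving normalisation, taking values in {1,…,T}.
-- (The value λ u u is irrelevant and unconstrained.)
record TemporalClique (n : ℕ) : Set where
  field
    label    : Fin n → Fin n → ℕ
    symm     : ∀ u v → label u v ≡ label v u
    inRange  : ∀ u v → u ≢ v → 1 ≤ label u v × label u v ≤ lifetime n
    distinct : ∀ u v u' v' → u ≢ v → u' ≢ v' → label u v ≡ label u' v' →
               (u ≡ u' × v ≡ v') ⊎ (u ≡ v' × v ≡ u')
open TemporalClique public

-- An ordering of the agents is a list (left to right);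
-- a schedule is a list of crossings, the t-th element (t = 1,2,…) being the
-- pair x_t = (u , v) with u immediately to the left of v in π_{t-1}.
data Schedule {n : ℕ} : List (Fin n) → List (Fin n × Fin n) → Set where
  []   : ∀ {π} → Schedule π []
  swap : ∀ (xs ys : List (Fin n)) {u v : Fin n} {x : List (Fin n × Fin n)} →
         Schedule (xs ++ v ∷ u ∷ ys) x →
         Schedule (xs ++ u ∷ v ∷ ys) ((u , v) ∷ x)

-- In G_{π,x}: the edge uv carries label t, i.e. x_t = {u,v} (1-based time t).
CrossesAt : ∀ {n} → List (Fin n × Fin n) → ℕ → Fin n → Fin n → Set
CrossesAt x t u v =
  Σ (Fin (length x)) λ i →
    suc (toℕ i) ≡ t × (lookup x i ≡ (u , v) ⊎ lookup x i ≡ (v , u))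

CrossesExactlyOnce : ∀ {n} → List (Fin n × Fin n) → Set
CrossesExactlyOnce {n} x =
  ∀ (u v : Fin n) → u ≢ v →
    (∃[ t ] CrossesAt x t u v) ×
    (∀ t t' → CrossesAt x t u v → CrossesAt x t' u v → t ≡ t')

IsomorphicTo : ∀ {n} → TemporalClique n → List (Fin n × Fin n) → Set
IsomorphicTo {n} G x =
  Σ (Fin n ↔ Fin n) λ σ →
    let f = Inverse.to σ in
    ∀ (u v : Fin n) (t : ℕ) → u ≢ v → (label G u v ≡ t ⇔ CrossesAt x t (f u) (f v))

Is1DMobility : ∀ {n} → TemporalClique n → Set
Is1DMobility {n} G =
  Σ (List (Fin n)) λ π → π ↭ allFin n ×
  Σ (List (Fin n × Fin n)) λ x → Schedule π x × CrossesExactlyOnce x × IsomorphicTo G x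

ExcludesForbiddenPatterns : ∀ {n} → TemporalClique n → (Fin n ↔ Fin n) → Set
ExcludesForbiddenPatterns {n} G ord =
  ∀ (i j k : Fin n) → i <ᶠ j → j <ᶠ k →
    let a = Inverse.to ord i ; b = Inverse.to ord j ; c = Inverse.to ord k in
    (label G a b < label G a c × label G a c < label G b c) ⊎
    (label G b c < label G a c × label G a c < label G a b)

-- Forward direction: order the vertices as the agents stand initially.  For agents p, q, r in
-- this order, p and r can only become adjacent once q has left the stretch between them, so pr
-- crosses after pq or qr; and once, say, pq has crossed, the agents stand as q, p, r, so by the
-- same argument pr crosses before qr.  Hence λ(pr) lies between λ(pq) and λ(qr).
--
-- Backward direction: identify each vertex with its position in the ordering.  The T increasing
-- pairs carry distinct labels in [1, T], so every time t is the label of exactly one pair u < v.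
-- Start from the identity order and cross u and v at time t.  By induction, after t crossings
-- a stands left of b iff either a < b and λ(ab) > t, or b < a and λ(ab) ≤ t; the pattern
-- condition rules out any agent between u and v at that moment, so each crossing is legal.

module Submission where

open import Defs
open import Data.Nat using (ℕ; zero; suc; _+_; _*_; _∸_; _≤_; _<_; z≤n; s≤s)
import Data.Nat.Properties as ℕ
open import Data.Nat.DivMod using (_/_; m*n/n≡m)
open import Data.Fin as Fin using (Fin; toℕ; fromℕ<; cast; punchOut) renaming (_<_ to _<ᶠ_)
import Data.Fin.Properties as Fin
open import Data.List using (List; []; _∷_; _++_; length; lookup; allFin; tabulate; map)
open import Data.List.Properties using (length-++; length-map; length-tabulate)
open import Data.List.Membership.Propositional using (_∈_)
open import Data.List.Membership.Propositional.Properties using (∈-lookup; ∈-allFin; ∈-++⁺ʳ; ∈-map⁻)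
open import Data.List.Relation.Binary.Disjoint.Propositional using (Disjoint)
open import Data.List.Relation.Unary.Any using (here; there; index)
open import Data.List.Relation.Unary.Any.Properties using (lookup-index)
open import Data.List.Relation.Unary.All as All using (All)
import Data.List.Relation.Unary.All.Properties as All
open import Data.List.Relation.Unary.AllPairs using (AllPairs; []; _∷_)
open import Data.List.Relation.Unary.AllPairs.Properties using (tabulate⁺-<)
open import Data.List.Relation.Unary.Unique.Propositional using (Unique)
import Data.List.Relation.Unary.Unique.Propositional.Properties as Unique
open import Data.List.Relation.Binary.Permutation.Propositional
  using (_↭_; ↭-refl; ↭-swap; ↭-sym; ↭-trans; ↭⇒↭ₛ)
open import Data.List.Relation.Binary.Permutation.Propositional.Properties
  using (++⁺ˡ; ∈-resp-↭; ↭-length)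
open import Data.List.Relation.Binary.Permutation.Setoid.Properties using (Unique-resp-↭)
open import Data.Product using (Σ; ∃; ∃₂; _×_; _,_; _,′_; proj₁; proj₂; uncurry)
import Data.Product as Product
open import Data.Product.Properties using (≡-dec; ,-injectiveˡ; ,-injectiveʳ)
open import Data.Sum using (_⊎_; inj₁; inj₂)
import Data.Sum as Sum
open import Data.Empty using (⊥; ⊥-elim)
open import Function using (_∘_; id)
open import Function.Bundles using (_↔_; _⇔_; Inverse; Injection; Equivalence; mk↔ₛ′; mk⇔)
open import Function.Properties.Inverse using (↔⇒↣)
open import Function.Construct.Composition using (_↔-∘_)
open import Function.Construct.Symmetry using (↔-sym)
open import Relation.Binary.Definitions using (tri<; tri≈; tri>)
open import Relation.Binary.PropositionalEquality
open import Relation.Nullary using (¬_; Dec; yes; no; contradiction)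

private variable
  A : Set
  p q r u v : A
  l xs ys : List A
  m n t : ℕ
  e : Fin n × Fin n
  x : List (Fin n × Fin n)
  π : List (Fin n)

data Before {A : Set} (p q : A) : List A → Set where
  first : q ∈ l → Before p q (p ∷ l)
  rest  : ∀ {a} → Before p q l → Before p q (a ∷ l)

Before⇒∈ʳ : Before p q l → q ∈ l
Before⇒∈ʳ (first q∈l) = there q∈l
Before⇒∈ʳ (rest pq)   = there (Before⇒∈ʳ pq)

AllPairs⇒Before⇒R : ∀ {R : A → A → Set} → AllPairs R l → Before p q l → R p q
AllPairs⇒Before⇒R (Rp ∷ _) (first q∈l) = All.lookup Rp q∈l
AllPairs⇒Before⇒R (_ ∷ Rl) (rest pq)   = AllPairs⇒Before⇒R Rl pq

Before⇒≢ : Unique l → Before p q l → p ≢ q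
Before⇒≢ = AllPairs⇒Before⇒R

Before-trans : Unique l → Before p q l → Before q r l → Before p r l
Before-trans (_ ∷ _)  (first _)   (rest qr)  = first (Before⇒∈ʳ qr)
Before-trans (p∉ ∷ _) (first q∈l) (first _)  = contradiction refl (All.lookup p∉ q∈l)
Before-trans (q∉ ∷ _) (rest pq)   (first _)  = contradiction refl (All.lookup q∉ (Before⇒∈ʳ pq))
Before-trans (_ ∷ U)  (rest pq)   (rest qr)  = rest (Before-trans U pq qr)

Before-asym : Unique l → Before p q l → Before q p l → ⊥
Before-asym U pq qp = Before⇒≢ U (Before-trans U pq qp) refl

Before-total : p ∈ l → q ∈ l → p ≢ q → Before p q l ⊎ Before q p l
Before-total (here refl)  (here refl)  p≢q = contradiction refl p≢q
Before-total (here refl)  (there q∈l)  _   = inj₁ (first q∈l)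
Before-total (there p∈l)  (here refl)  _   = inj₂ (first p∈l)
Before-total (there p∈l)  (there q∈l)  p≢q = Sum.map rest rest (Before-total p∈l q∈l p≢q)

Before-adjacent : ∀ xs → Before u v (xs ++ u ∷ v ∷ ys)
Before-adjacent []       = first (here refl)
Before-adjacent (_ ∷ xs) = rest (Before-adjacent xs)

Before⇒adjacent⊎between : Before p q l →
  (∃₂ λ xs ys → l ≡ xs ++ p ∷ q ∷ ys) ⊎ (∃ λ b → Before p b l × Before b q l)
Before⇒adjacent⊎between (first (here refl))  = inj₁ ([] , _ , refl)
Before⇒adjacent⊎between (first (there q∈l))  = inj₂ (_ , first (here refl) , rest (first q∈l))
Before⇒adjacent⊎between (rest pq) with Before⇒adjacent⊎between pq
... | inj₁ (xs , ys , refl) = inj₁ (_ ∷ xs , ys , refl)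
... | inj₂ (b , pb , bq)    = inj₂ (b , rest pb , rest bq)

adjacent≢outer : ∀ xs → Unique (xs ++ u ∷ v ∷ ys) →
  Before p q (xs ++ u ∷ v ∷ ys) → Before q r (xs ++ u ∷ v ∷ ys) → (u ,′ v) ≢ (p , r)
adjacent≢outer []       U            pp (first _)          refl = Before⇒≢ U pp refl
adjacent≢outer []       (_ ∷ r∉ ∷ _) _ (rest (first r∈ys)) refl =
  contradiction refl (All.lookup r∉ r∈ys)
adjacent≢outer []       (_ ∷ r∉ ∷ _) _ (rest (rest qr)) refl =
  contradiction refl (All.lookup r∉ (Before⇒∈ʳ qr))
adjacent≢outer (_ ∷ xs) (p∉ ∷ _) (first _) _ refl =
  contradiction refl (All.lookup p∉ (∈-++⁺ʳ xs (here refl)))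
adjacent≢outer (_ ∷ _)  (q∉ ∷ _) (rest pq) (first _) refl =
  contradiction refl (All.lookup q∉ (Before⇒∈ʳ pq))
adjacent≢outer (_ ∷ xs) (_ ∷ U)  (rest pq) (rest qr) = adjacent≢outer xs U pq qr

swap-↭ : ∀ xs → xs ++ u ∷ v ∷ ys ↭ xs ++ v ∷ u ∷ ys
swap-↭ xs = ++⁺ˡ xs (↭-swap _ _ ↭-refl)

Unique-swap : ∀ xs → Unique (xs ++ u ∷ v ∷ ys) → Unique (xs ++ v ∷ u ∷ ys)
Unique-swap xs = Unique-resp-↭ (setoid _) (↭⇒↭ₛ (swap-↭ xs))

Before-swap : ∀ xs → (u ,′ v) ≢ (p , q) →
  Before p q (xs ++ u ∷ v ∷ ys) → Before p q (xs ++ v ∷ u ∷ ys)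
Before-swap []       uv≢pq (first (here refl))  = contradiction refl uv≢pq
Before-swap []       _     (first (there q∈ys)) = rest (first q∈ys)
Before-swap []       _     (rest (first q∈ys))  = first (there q∈ys)
Before-swap []       _     (rest (rest pq))     = rest (rest pq)
Before-swap (_ ∷ xs) _     (first q∈l)          = first (∈-resp-↭ (swap-↭ xs) q∈l)
Before-swap (_ ∷ xs) uv≢pq (rest pq)            = rest (Before-swap xs uv≢pq pq)

lookup-Before : ∀ (l : List A) {i j} → i <ᶠ j → Before (lookup l i) (lookup l j) l
lookup-Before (_ ∷ l) {Fin.zero}  {Fin.suc j} _         = first (∈-lookup j)
lookup-Before (_ ∷ l) {Fin.suc i} {Fin.suc j} (s≤s i<j) = rest (lookup-Before l i<j)

lookup-injective : Unique l → ∀ {i j} → lookup l i ≡ lookup l j → i ≡ j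
lookup-injective {l = l} U {i} {j} eq with Fin.<-cmp i j
... | tri< i<j _ _ = contradiction eq (Before⇒≢ U (lookup-Before l i<j))
... | tri≈ _ i≡j _ = i≡j
... | tri> _ _ j<i = contradiction (sym eq) (Before⇒≢ U (lookup-Before l j<i))

lookup↔ : (l : List A) → Unique l → (∀ a → a ∈ l) → Fin (length l) ↔ A
lookup↔ l U complete = mk↔ₛ′ (lookup l) (index ∘ complete)
  (λ a → sym (lookup-index (complete a)))
  (λ i → lookup-injective U (sym (lookup-index (complete (lookup l i)))))

cast↔ : m ≡ n → Fin m ↔ Fin n
cast↔ eq = mk↔ₛ′ (cast eq) (cast (sym eq))
  (Fin.cast-involutive eq (sym eq)) (Fin.cast-involutive (sym eq) eq)

↭-allFin⇒Unique : π ↭ allFin n → Unique π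
↭-allFin⇒Unique {n = n} π↭ = Unique-resp-↭ (setoid _) (↭⇒↭ₛ (↭-sym π↭)) (Unique.allFin⁺ n)

↭-allFin⇒∈ : π ↭ allFin n → ∀ a → a ∈ π
↭-allFin⇒∈ π↭ a = ∈-resp-↭ (↭-sym π↭) (∈-allFin a)

Between : ℕ → ℕ → ℕ → Set
Between y x z = (y < x × x < z) ⊎ (z < x × x < y)

Between-suc : ∀ {x y z} → Between y x z → Between (suc y) (suc x) (suc z)
Between-suc = Sum.map (Product.map s≤s s≤s) (Product.map s≤s s≤s)

Between⇒¬below : ∀ {x y z} → Between y x z → x < y → x < z → ⊥
Between⇒¬below (inj₁ (y<x , _)) x<y _ = ℕ.<-asym y<x x<y
Between⇒¬below (inj₂ (z<x , _)) _ x<z = ℕ.<-asym z<x x<z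

Between⇒¬above : ∀ {x y z} → Between y x z → y < x → z < x → ⊥
Between⇒¬above (inj₁ (_ , x<z)) _ z<x = ℕ.<-asym z<x x<z
Between⇒¬above (inj₂ (_ , x<y)) y<x _ = ℕ.<-asym y<x x<y

Joins : A × A → A → A → Set
Joins e p q = e ≡ (p , q) ⊎ e ≡ (q , p)

_≟ᵖ_ : (e e′ : Fin n × Fin n) → Dec (e ≡ e′)
_≟ᵖ_ = ≡-dec Fin._≟_ Fin._≟_

-- CrossesAt x t p q unfolds to a Σ-type from which x cannot be recovered, hence the
-- explicit {x = …} arguments below.
CrossesAt⇒1≤ : CrossesAt x t p q → 1 ≤ t
CrossesAt⇒1≤ (_ , refl , _) = s≤s z≤n

CrossesAt-sym : CrossesAt x t p q → CrossesAt x t q p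
CrossesAt-sym (i , eq , j) = i , eq , Sum.swap j

CrossesAt-here : Joins e p q → CrossesAt (e ∷ x) 1 p q
CrossesAt-here j = Fin.zero , refl , j

CrossesAt-there : CrossesAt x t p q → CrossesAt (e ∷ x) (suc t) p q
CrossesAt-there (i , eq , j) = Fin.suc i , cong suc eq , j

CrossesAt-∷⁻ : CrossesAt (e ∷ x) t p q →
  (t ≡ 1 × Joins e p q) ⊎ ∃ λ t′ → t ≡ suc t′ × CrossesAt x t′ p q
CrossesAt-∷⁻ (Fin.zero  , refl , j) = inj₁ (refl , j)
CrossesAt-∷⁻ (Fin.suc i , refl , j) = inj₂ (_ , refl , i , refl , j)

AtMostOnce : List (Fin n × Fin n) → Fin n → Fin n → Set
AtMostOnce x p q = ∀ {t t′} → CrossesAt x t p q → CrossesAt x t′ p q → t ≡ t′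

AtMostOnce-∷⁻ : AtMostOnce (e ∷ x) p q → AtMostOnce x p q
AtMostOnce-∷⁻ once c c′ = ℕ.suc-injective (once (CrossesAt-there c) (CrossesAt-there c′))

AtMostOnce-head : AtMostOnce ((p , q) ∷ x) p q → ¬ CrossesAt x t p q
AtMostOnce-head {x = x} once c = ℕ.<⇒≢ (CrossesAt⇒1≤ {x = x} c)
  (ℕ.suc-injective (once (CrossesAt-here {x = x} (inj₁ refl)) (CrossesAt-there {x = x} c)))

CrossesAt-tabulate⁺ : (f : Fin m → Fin n × Fin n) (k : Fin m) → Joins (f k) p q →
  CrossesAt (tabulate f) (suc (toℕ k)) p q
CrossesAt-tabulate⁺ f Fin.zero    j = CrossesAt-here {x = tabulate (f ∘ Fin.suc)} j
CrossesAt-tabulate⁺ f (Fin.suc k) j =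
  CrossesAt-there {x = tabulate (f ∘ Fin.suc)} (CrossesAt-tabulate⁺ (f ∘ Fin.suc) k j)

CrossesAt-tabulate⁻ : (f : Fin m → Fin n × Fin n) → CrossesAt (tabulate f) t p q →
  ∃ λ k → suc (toℕ k) ≡ t × Joins (f k) p q
CrossesAt-tabulate⁻ {zero}  f (() , _)
CrossesAt-tabulate⁻ {suc m} f c with CrossesAt-∷⁻ {x = tabulate (f ∘ Fin.suc)} c
... | inj₁ (refl , j)      = Fin.zero , refl , j
... | inj₂ (_ , refl , c′) =
  let k , eq , j = CrossesAt-tabulate⁻ (f ∘ Fin.suc) c′ in Fin.suc k , cong suc eq , j

Joins-oriented : ∀ xs → Unique (xs ++ u ∷ v ∷ ys) → Before p q (xs ++ u ∷ v ∷ ys) →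
  Joins (u , v) p q → (u ,′ v) ≡ (p , q)
Joins-oriented _  _ _  (inj₁ uv≡pq) = uv≡pq
Joins-oriented xs U pq (inj₂ refl)  = ⊥-elim (Before-asym U pq (Before-adjacent xs))

CrossesAt-later : ∀ xs → Unique (xs ++ u ∷ v ∷ ys) → Before p q (xs ++ u ∷ v ∷ ys) →
  (u ,′ v) ≢ (p , q) → CrossesAt ((u , v) ∷ x) t p q →
  ∃ λ t′ → t ≡ suc t′ × CrossesAt x t′ p q
CrossesAt-later xs U pq uv≢pq c with CrossesAt-∷⁻ c
... | inj₁ (_ , j) = contradiction (Joins-oriented xs U pq j) uv≢pq
... | inj₂ later   = later

outer-crossing-preceded : Schedule π x → Unique π → Before p q π → Before q r π →
  CrossesAt x t p r → ∃ λ t′ → t′ < t × (CrossesAt x t′ p q ⊎ CrossesAt x t′ q r)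
outer-crossing-preceded [] _ _ _ (() , _)
outer-crossing-preceded {p = p} {q} {r} (swap xs _ {u} {v} {x} sched) U pq qr cpr
  with CrossesAt-later xs U (Before-trans U pq qr) (adjacent≢outer xs U pq qr) cpr
... | t′ , refl , cpr′ with (u , v) ≟ᵖ (p , q) | (u , v) ≟ᵖ (q , r)
... | yes refl | _        = 1 , s≤s (CrossesAt⇒1≤ {x = x} cpr′) ,
                            inj₁ (CrossesAt-here {x = x} (inj₁ refl))
... | no _     | yes refl = 1 , s≤s (CrossesAt⇒1≤ {x = x} cpr′) ,
                            inj₂ (CrossesAt-here {x = x} (inj₁ refl))
... | no uv≢pq | no uv≢qr =
  let t″ , t″<t′ , c = outer-crossing-preceded sched (Unique-swap xs U)
                         (Before-swap xs uv≢pq pq) (Before-swap xs uv≢qr qr) cpr′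
  in suc t″ , s≤s t″<t′ , Sum.map (CrossesAt-there {x = x}) (CrossesAt-there {x = x}) c

-- After pq crosses the agents stand as q, p, r, so pr crosses before qr.
crossing-times-left-first : ∀ {tpq tqr tpr} xs → Schedule (xs ++ q ∷ p ∷ ys) x →
  Unique (xs ++ p ∷ q ∷ ys) → Before q r (xs ++ p ∷ q ∷ ys) →
  AtMostOnce ((p , q) ∷ x) p q → AtMostOnce ((p , q) ∷ x) p r →
  CrossesAt ((p , q) ∷ x) tpq p q → CrossesAt ((p , q) ∷ x) tqr q r →
  CrossesAt ((p , q) ∷ x) tpr p r → tpq < tpr × tpr < tqr
crossing-times-left-first {x = x} xs sched U qr once-pq once-pr cpq cqr cpr
  with Before-trans U (Before-adjacent xs) qr | Before⇒≢ U (Before-adjacent xs) | Before⇒≢ U qr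
... | pr | p≢q | q≢r
  with CrossesAt-later xs U qr (p≢q ∘ ,-injectiveˡ) cqr
     | CrossesAt-later xs U pr (q≢r ∘ ,-injectiveʳ) cpr
... | tqr′ , refl , cqr′ | tpr′ , refl , cpr′
  with outer-crossing-preceded sched (Unique-swap xs U)
         (Before-adjacent xs) (Before-swap xs (q≢r ∘ ,-injectiveʳ) pr) cqr′
... | _ , _ , inj₁ cqp = ⊥-elim (AtMostOnce-head {x = x} once-pq (CrossesAt-sym {x = x} cqp))
... | _ , t′<tqr′ , inj₂ cpr″ =
  subst (_< suc tpr′) (once-pq (CrossesAt-here {x = x} (inj₁ refl)) cpq)
    (s≤s (CrossesAt⇒1≤ {x = x} cpr′)) ,
  subst (_< suc tqr′) (once-pr (CrossesAt-there {x = x} cpr″) cpr) (s≤s t′<tqr′)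

crossing-times-right-first : ∀ {tpq tqr tpr} xs → Schedule (xs ++ r ∷ q ∷ ys) x →
  Unique (xs ++ q ∷ r ∷ ys) → Before p q (xs ++ q ∷ r ∷ ys) →
  AtMostOnce ((q , r) ∷ x) q r → AtMostOnce ((q , r) ∷ x) p r →
  CrossesAt ((q , r) ∷ x) tpq p q → CrossesAt ((q , r) ∷ x) tqr q r →
  CrossesAt ((q , r) ∷ x) tpr p r → tqr < tpr × tpr < tpq
crossing-times-right-first {x = x} xs sched U pq once-qr once-pr cpq cqr cpr
  with Before-trans U pq (Before-adjacent xs) | Before⇒≢ U pq
... | pr | p≢q
  with CrossesAt-later xs U pq (p≢q ∘ sym ∘ ,-injectiveˡ) cpq
     | CrossesAt-later xs U pr (p≢q ∘ sym ∘ ,-injectiveˡ) cpr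
... | tpq′ , refl , cpq′ | tpr′ , refl , cpr′
  with outer-crossing-preceded sched (Unique-swap xs U)
         (Before-swap xs (p≢q ∘ sym ∘ ,-injectiveˡ) pr) (Before-adjacent xs) cpq′
... | _ , _ , inj₂ crq = ⊥-elim (AtMostOnce-head {x = x} once-qr (CrossesAt-sym {x = x} crq))
... | _ , t′<tpq′ , inj₁ cpr″ =
  subst (_< suc tpr′) (once-qr (CrossesAt-here {x = x} (inj₁ refl)) cqr)
    (s≤s (CrossesAt⇒1≤ {x = x} cpr′)) ,
  subst (_< suc tpq′) (once-pr (CrossesAt-there {x = x} cpr″) cpr) (s≤s t′<tpq′)

crossing-times-between : ∀ {tpq tqr tpr} → Schedule π x → Unique π →
  Before p q π → Before q r π →
  AtMostOnce x p q → AtMostOnce x q r → AtMostOnce x p r →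
  CrossesAt x tpq p q → CrossesAt x tqr q r → CrossesAt x tpr p r → Between tpq tpr tqr
crossing-times-between [] _ _ _ _ _ _ (() , _) _ _
crossing-times-between {p = p} {q} {r} (swap xs _ {u} {v} sched) U pq qr once-pq once-qr once-pr cpq cqr cpr
  with (u , v) ≟ᵖ (p , q) | (u , v) ≟ᵖ (q , r)
... | yes refl | _ = inj₁ (crossing-times-left-first xs sched U qr once-pq once-pr cpq cqr cpr)
... | no _ | yes refl = inj₂ (crossing-times-right-first xs sched U pq once-qr once-pr cpq cqr cpr)
... | no uv≢pq | no uv≢qr
  with CrossesAt-later xs U pq uv≢pq cpq | CrossesAt-later xs U qr uv≢qr cqr
     | CrossesAt-later xs U (Before-trans U pq qr) (adjacent≢outer xs U pq qr) cpr
... | _ , refl , cpq′ | _ , refl , cqr′ | _ , refl , cpr′ =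
  Between-suc (crossing-times-between sched (Unique-swap xs U)
    (Before-swap xs uv≢pq pq) (Before-swap xs uv≢qr qr)
    (AtMostOnce-∷⁻ once-pq) (AtMostOnce-∷⁻ once-qr) (AtMostOnce-∷⁻ once-pr) cpq′ cqr′ cpr′)

mobility⇒ordering : (G : TemporalClique n) → Is1DMobility G →
  Σ (Fin n ↔ Fin n) (ExcludesForbiddenPatterns G)
mobility⇒ordering {n} G (π , π↭ , x , sched , once , σ , iso) = ord , excludes
  where
  module σ = Inverse σ

  U : Unique π
  U = ↭-allFin⇒Unique π↭

  n≡length : n ≡ length π
  n≡length = sym (trans (↭-length π↭) (length-tabulate id))

  agent : Fin n → Fin n
  agent i = lookup π (cast n≡length i)

  ord : Fin n ↔ Fin n
  ord = ↔-sym σ ↔-∘ (lookup↔ π U (↭-allFin⇒∈ π↭) ↔-∘ cast↔ n≡length)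

  before : ∀ {i j} → i <ᶠ j → Before (agent i) (agent j) π
  before {i} {j} i<j = lookup-Before π
    (subst₂ _<_ (sym (Fin.toℕ-cast n≡length i)) (sym (Fin.toℕ-cast n≡length j)) i<j)

  crosses : ∀ {a b} → a ≢ b → CrossesAt x (label G (σ.from a) (σ.from b)) a b
  crosses {a} {b} a≢b = subst₂ (CrossesAt x _) (σ.strictlyInverseˡ a) (σ.strictlyInverseˡ b)
    (Equivalence.to (iso _ _ _ (a≢b ∘ Injection.injective (↔⇒↣ (↔-sym σ)))) refl)

  at-most-once : ∀ {a b} → a ≢ b → AtMostOnce x a b
  at-most-once {a} {b} a≢b = proj₂ (once a b a≢b) _ _

  excludes : ExcludesForbiddenPatterns G ord
  excludes i j k i<j j<k = crossing-times-between sched U ij jk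
    (at-most-once (Before⇒≢ U ij)) (at-most-once (Before⇒≢ U jk)) (at-most-once (Before⇒≢ U ik))
    (crosses (Before⇒≢ U ij)) (crosses (Before⇒≢ U jk)) (crosses (Before⇒≢ U ik))
    where
    ij : Before (agent i) (agent j) π
    ij = before i<j
    jk : Before (agent j) (agent k) π
    jk = before j<k
    ik : Before (agent i) (agent k) π
    ik = Before-trans U ij jk

Fin-injective⇒surjective : (f : Fin m → Fin n) → m ≡ n →
  (∀ {i j} → f i ≡ f j → i ≡ j) → ∀ y → ∃ λ i → f i ≡ y
Fin-injective⇒surjective {n = suc n} f refl f-injective y with Fin.any? (λ i → f i Fin.≟ y)
... | yes hit = hit
... | no miss with Fin.pigeonhole (ℕ.n<1+n n) (λ i → punchOut {i = y} (miss ∘ (i ,_) ∘ sym))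
... | i , j , i<j , eq = contradiction (f-injective (Fin.punchOut-injective {i = y} _ _ eq)) (Fin.<⇒≢ i<j)

increasingPairs : ∀ n → List (Fin n × Fin n)
increasingPairs zero    = []
increasingPairs (suc n) =
  map (λ j → Fin.zero , Fin.suc j) (allFin n) ++ map (Product.map Fin.suc Fin.suc) (increasingPairs n)

increasingPairs-increasing : ∀ n → All (λ e → proj₁ e <ᶠ proj₂ e) (increasingPairs n)
increasingPairs-increasing zero    = All.[]
increasingPairs-increasing (suc n) = All.++⁺
  (All.map⁺ (All.universal (λ _ → s≤s z≤n) (allFin n)))
  (All.map⁺ (All.map s≤s (increasingPairs-increasing n)))

increasingPairs-unique : ∀ n → Unique (increasingPairs n)
increasingPairs-unique zero    = []
increasingPairs-unique (suc n) = Unique.++⁺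
  (Unique.map⁺ (Fin.suc-injective ∘ ,-injectiveʳ) (Unique.allFin⁺ n))
  (Unique.map⁺ (λ eq → cong₂ _,_ (Fin.suc-injective (,-injectiveˡ eq)) (Fin.suc-injective (,-injectiveʳ eq)))
     (increasingPairs-unique n))
  disjoint
  where
  disjoint : Disjoint (map (λ j → Fin.zero , Fin.suc j) (allFin n))
                      (map (Product.map Fin.suc Fin.suc) (increasingPairs n))
  disjoint (e∈zeros , e∈sucs) with ∈-map⁻ _ e∈zeros | ∈-map⁻ _ e∈sucs
  ... | _ , _ , refl | _ , _ , ()

length-increasingPairs-suc : ∀ n → length (increasingPairs (suc n)) ≡ n + length (increasingPairs n)
length-increasingPairs-suc n = trans (length-++ (map _ (allFin n)))
  (cong₂ _+_ (trans (length-map _ (allFin n)) (length-tabulate id)) (length-map _ (increasingPairs n)))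

length-increasingPairs : ∀ n → length (increasingPairs n) ≡ lifetime n
length-increasingPairs n = begin
  length (increasingPairs n)            ≡⟨ m*n/n≡m (length (increasingPairs n)) 2 ⟨
  length (increasingPairs n) * 2 / 2    ≡⟨ cong (_/ 2) (double n) ⟩
  lifetime n                            ∎
  where
  open ≡-Reasoning
  triangular : ∀ n → n * 2 + n * (n ∸ 1) ≡ suc n * n
  triangular zero    = refl
  triangular (suc n) = trans (sym (ℕ.*-distribˡ-+ (suc n) 2 n)) (ℕ.*-comm (suc n) (2 + n))
  double : ∀ n → length (increasingPairs n) * 2 ≡ n * (n ∸ 1)
  double zero    = refl
  double (suc n) = begin
    length (increasingPairs (suc n)) * 2    ≡⟨ cong (_* 2) (length-increasingPairs-suc n) ⟩
    (n + length (increasingPairs n)) * 2    ≡⟨ ℕ.*-distribʳ-+ 2 n (length (increasingPairs n)) ⟩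
    n * 2 + length (increasingPairs n) * 2  ≡⟨ cong (n * 2 +_) (double n) ⟩
    n * 2 + n * (n ∸ 1)                     ≡⟨ triangular n ⟩
    suc n * n                               ∎

LabelledEdge : (Fin n → Fin n → ℕ) → ℕ → Fin n × Fin n → Set
LabelledEdge L s e = proj₁ e <ᶠ proj₂ e × uncurry L e ≡ s

-- Labels are 1-based, Fin indices 0-based.
fromLabel : 1 ≤ m × m ≤ n → Fin n
fromLabel {suc m} (_ , m≤n) = fromℕ< m≤n

suc-toℕ-fromLabel : (r : 1 ≤ m × m ≤ n) → suc (toℕ (fromLabel r)) ≡ m
suc-toℕ-fromLabel {suc m} (_ , m≤n) = cong suc (Fin.toℕ-fromℕ< m≤n)

every-time-is-a-label : (L : Fin n → Fin n → ℕ) →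
  (∀ {a b} → a <ᶠ b → 1 ≤ L a b × L a b ≤ lifetime n) →
  (∀ {a b a′ b′} → a <ᶠ b → a′ <ᶠ b′ → L a b ≡ L a′ b′ → (a , b) ≡ (a′ , b′)) →
  (t : Fin (lifetime n)) → ∃ (LabelledEdge L (suc (toℕ t)))
every-time-is-a-label {n} L L-range L-injective t =
  let k , time-k≡t = Fin-injective⇒surjective time (length-increasingPairs n) time-injective t
  in edge k , increasing k , trans (sym (suc-time k)) (cong (suc ∘ toℕ) time-k≡t)
  where
  edge : Fin (length (increasingPairs n)) → Fin n × Fin n
  edge = lookup (increasingPairs n)

  increasing : ∀ k → proj₁ (edge k) <ᶠ proj₂ (edge k)
  increasing k = All.lookup (increasingPairs-increasing n) (∈-lookup k)

  time : Fin (length (increasingPairs n)) → Fin (lifetime n)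
  time k = fromLabel (L-range (increasing k))

  suc-time : ∀ k → suc (toℕ (time k)) ≡ uncurry L (edge k)
  suc-time k = suc-toℕ-fromLabel (L-range (increasing k))

  time-injective : ∀ {k k′} → time k ≡ time k′ → k ≡ k′
  time-injective {k} {k′} eq = lookup-injective (increasingPairs-unique n)
    (L-injective (increasing k) (increasing k′)
      (trans (sym (suc-time k)) (trans (cong (suc ∘ toℕ) eq) (suc-time k′))))

module _ (G : TemporalClique n) (ord : Fin n ↔ Fin n) (excludes : ExcludesForbiddenPatterns G ord) where
  private
    module ord = Inverse ord

    to-injective : ∀ {i j} → ord.to i ≡ ord.to j → i ≡ j
    to-injective = Injection.injective (↔⇒↣ ord)

  L : Fin n → Fin n → ℕ
  L i j = label G (ord.to i) (ord.to j)

  L-sym : ∀ i j → L i j ≡ L j i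
  L-sym i j = symm G _ _

  L-range : ∀ {i j} → i ≢ j → 1 ≤ L i j × L i j ≤ lifetime n
  L-range i≢j = inRange G _ _ (i≢j ∘ to-injective)

  L-distinct : ∀ {i j i′ j′} → i ≢ j → i′ ≢ j′ → L i j ≡ L i′ j′ → Joins (i , j) i′ j′
  L-distinct i≢j i′≢j′ eq
    with distinct G _ _ _ _ (i≢j ∘ to-injective) (i′≢j′ ∘ to-injective) eq
  ... | inj₁ (e₁ , e₂) = inj₁ (cong₂ _,_ (to-injective e₁) (to-injective e₂))
  ... | inj₂ (e₁ , e₂) = inj₂ (cong₂ _,_ (to-injective e₁) (to-injective e₂))

  L-injective : ∀ {i j i′ j′} → i <ᶠ j → i′ <ᶠ j′ → L i j ≡ L i′ j′ → (i , j) ≡ (i′ , j′)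
  L-injective i<j i′<j′ eq with L-distinct (Fin.<⇒≢ i<j) (Fin.<⇒≢ i′<j′) eq
  ... | inj₁ ij≡i′j′ = ij≡i′j′
  ... | inj₂ refl    = ⊥-elim (ℕ.<-asym i<j i′<j′)

  -- Agents are positions of the ordering; PrecedesAt t a b says that a stands left of b after
  -- the crossings at times 1, …, t.
  PrecedesAt : ℕ → Fin n → Fin n → Set
  PrecedesAt t a b = (a <ᶠ b × t < L a b) ⊎ (b <ᶠ a × L a b ≤ t)

  PrecedesAt-irrefl : ∀ {a} → ¬ PrecedesAt t a a
  PrecedesAt-irrefl (inj₁ (a<a , _)) = ℕ.<-irrefl refl a<a
  PrecedesAt-irrefl (inj₂ (a<a , _)) = ℕ.<-irrefl refl a<a

  OrderedAt : ℕ → List (Fin n) → Set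
  OrderedAt t π = ∀ {a b} → Before a b π → PrecedesAt t a b

  module _ {t u v} (u<v : u <ᶠ v) (Luv : L u v ≡ suc t) where

    PrecedesAt-suc : ∀ {a b} → (a ,′ b) ≢ (u , v) → PrecedesAt t a b → PrecedesAt (suc t) a b
    PrecedesAt-suc ab≢uv (inj₁ (a<b , t<Lab)) =
      inj₁ (a<b , ℕ.≤∧≢⇒< t<Lab (ab≢uv ∘ sym ∘ L-injective u<v a<b ∘ trans Luv))
    PrecedesAt-suc _     (inj₂ (b<a , Lab≤t)) = inj₂ (b<a , ℕ.m≤n⇒m≤1+n Lab≤t)

    -- In each case L u v = suc t is extreme in one of the triangles u<b<v, u<v<b or b<u<v.
    nothing-between-suc : ∀ {b} → PrecedesAt (suc t) u b → PrecedesAt (suc t) b v → ⊥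
    nothing-between-suc {b} (inj₁ (u<b , t<Lub)) (inj₁ (b<v , t<Lbv)) =
      Between⇒¬below (excludes _ _ _ u<b b<v)
        (subst (_< L u b) (sym Luv) t<Lub) (subst (_< L b v) (sym Luv) t<Lbv)
    nothing-between-suc {b} (inj₁ (u<b , t<Lub)) (inj₂ (v<b , Lbv≤t)) =
      Between⇒¬above (excludes _ _ _ u<v v<b) (subst (_< L u b) (sym Luv) t<Lub)
        (ℕ.≤-<-trans (ℕ.≤-reflexive (L-sym v b)) (ℕ.≤-<-trans Lbv≤t t<Lub))
    nothing-between-suc {b} (inj₂ (b<u , Lub≤t)) (inj₁ (b<v , t<Lbv)) =
      Between⇒¬above (excludes _ _ _ b<u u<v)
        (ℕ.≤-<-trans (ℕ.≤-reflexive (L-sym b u)) (ℕ.≤-<-trans Lub≤t t<Lbv))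
        (subst (_< L b v) (sym Luv) t<Lbv)
    nothing-between-suc (inj₂ (b<u , _)) (inj₂ (v<b , _)) = ℕ.<-asym u<v (ℕ.<-trans v<b b<u)

    nothing-between : ∀ {b} → PrecedesAt t u b → PrecedesAt t b v → ⊥
    nothing-between ub bv = nothing-between-suc
      (PrecedesAt-suc (PrecedesAt-irrefl ∘ (λ b≡v → subst (λ w → PrecedesAt t w v) b≡v bv) ∘ ,-injectiveʳ) ub)
      (PrecedesAt-suc (PrecedesAt-irrefl ∘ (λ b≡u → subst (PrecedesAt t u) b≡u ub) ∘ ,-injectiveˡ) bv)

    next-crossing-adjacent : ∀ {π} → OrderedAt t π → u ∈ π → v ∈ π →
      ∃₂ λ xs ys → π ≡ xs ++ u ∷ v ∷ ys
    next-crossing-adjacent ordered u∈π v∈π with Before-total u∈π v∈π (Fin.<⇒≢ u<v)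
    ... | inj₂ vu with ordered vu
    ...   | inj₁ (v<u , _)   = ⊥-elim (ℕ.<-asym u<v v<u)
    ...   | inj₂ (_ , Lvu≤t) = ⊥-elim (ℕ.n≮n t (subst (_≤ t) (trans (L-sym v u) Luv) Lvu≤t))
    next-crossing-adjacent ordered u∈π v∈π | inj₁ uv with Before⇒adjacent⊎between uv
    ... | inj₁ adjacent         = adjacent
    ... | inj₂ (_ , ub , bv)    = ⊥-elim (nothing-between (ordered ub) (ordered bv))

    OrderedAt-swap : ∀ xs {ys} → Unique (xs ++ u ∷ v ∷ ys) →
      OrderedAt t (xs ++ u ∷ v ∷ ys) → OrderedAt (suc t) (xs ++ v ∷ u ∷ ys)
    OrderedAt-swap xs U ordered {a} {b} ab with (v , u) ≟ᵖ (a , b)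
    ... | yes refl   = inj₂ (u<v , ℕ.≤-reflexive (trans (L-sym v u) Luv))
    ... | no vu≢ab = PrecedesAt-suc ab≢uv (ordered (Before-swap xs vu≢ab ab))
      where
      ab≢uv : (a ,′ b) ≢ (u , v)
      ab≢uv refl = Before-asym (Unique-swap xs U) ab (Before-adjacent xs)

  schedule : ∀ {m t π} (f : Fin m → Fin n × Fin n) →
    (∀ k → LabelledEdge L (suc (t + toℕ k)) (f k)) → π ↭ allFin n → OrderedAt t π →
    Schedule π (tabulate f)
  schedule {zero}      f _        _  _ = []
  schedule {suc m} {t} f labelled π↭ ordered
    with proj₁ (labelled Fin.zero) | trans (proj₂ (labelled Fin.zero)) (cong suc (ℕ.+-identityʳ t))
  ... | u<v | Luv
    with next-crossing-adjacent u<v Luv ordered (↭-allFin⇒∈ π↭ _) (↭-allFin⇒∈ π↭ _)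
  ... | xs , ys , refl = swap xs ys (schedule (f ∘ Fin.suc) labelled′
          (↭-trans (↭-sym (swap-↭ xs)) π↭)
          (OrderedAt-swap u<v Luv xs (↭-allFin⇒Unique π↭) ordered))
    where
    labelled′ : ∀ k → LabelledEdge L (suc (suc t + toℕ k)) (f (Fin.suc k))
    labelled′ k = proj₁ (labelled (Fin.suc k)) ,
                  trans (proj₂ (labelled (Fin.suc k))) (cong suc (ℕ.+-suc t (toℕ k)))

  edge : Fin (lifetime n) → Fin n × Fin n
  edge t = proj₁ (every-time-is-a-label L (L-range ∘ Fin.<⇒≢) L-injective t)

  edge-labelled : ∀ t → LabelledEdge L (suc (toℕ t)) (edge t)
  edge-labelled t = proj₂ (every-time-is-a-label L (L-range ∘ Fin.<⇒≢) L-injective t)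

  label⇒crosses : ∀ {a b} → a ≢ b → CrossesAt (tabulate edge) (L a b) a b
  label⇒crosses {a} {b} a≢b = subst (λ s → CrossesAt (tabulate edge) s a b) 1+time≡Lab
    (CrossesAt-tabulate⁺ edge time
      (L-distinct (Fin.<⇒≢ (proj₁ (edge-labelled time))) a≢b
        (trans (proj₂ (edge-labelled time)) 1+time≡Lab)))
    where
    time : Fin (lifetime n)
    time = fromLabel (L-range a≢b)
    1+time≡Lab : suc (toℕ time) ≡ L a b
    1+time≡Lab = suc-toℕ-fromLabel (L-range a≢b)

  crosses⇒label : ∀ {a b t} → CrossesAt (tabulate edge) t a b → L a b ≡ t
  crosses⇒label c with CrossesAt-tabulate⁻ edge c
  ... | k , refl , inj₁ eq = trans (cong (uncurry L) (sym eq)) (proj₂ (edge-labelled k))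
  ... | k , refl , inj₂ eq =
    trans (L-sym _ _) (trans (cong (uncurry L) (sym eq)) (proj₂ (edge-labelled k)))

  initially-ordered : OrderedAt 0 (allFin n)
  initially-ordered ab with AllPairs⇒Before⇒R (tabulate⁺-< id) ab
  ... | a<b = inj₁ (a<b , proj₁ (L-range (Fin.<⇒≢ a<b)))

  crosses-exactly-once : CrossesExactlyOnce (tabulate edge)
  crosses-exactly-once a b a≢b =
    (L a b , label⇒crosses a≢b) , λ _ _ c c′ → trans (sym (crosses⇒label c)) (crosses⇒label c′)

  isomorphic : IsomorphicTo G (tabulate edge)
  isomorphic = ↔-sym ord , λ u v t u≢v → mk⇔
    (λ Luv≡t → subst (λ s → CrossesAt (tabulate edge) s _ _) (trans (L-from u v) Luv≡t)
                 (label⇒crosses (u≢v ∘ from-injective)))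
    (λ c → trans (sym (L-from u v)) (crosses⇒label c))
    where
    from-injective : ∀ {u v} → ord.from u ≡ ord.from v → u ≡ v
    from-injective = Injection.injective (↔⇒↣ (↔-sym ord))
    L-from : ∀ u v → L (ord.from u) (ord.from v) ≡ label G u v
    L-from u v = cong₂ (label G) (ord.strictlyInverseˡ u) (ord.strictlyInverseˡ v)

  ordering⇒mobility : Is1DMobility G
  ordering⇒mobility = allFin n , ↭-refl , tabulate edge ,
    schedule edge edge-labelled ↭-refl initially-ordered , crosses-exactly-once , isomorphic

mainTheorem1 : (n : ℕ) (G : TemporalClique n) →
    Is1DMobility G ⇔ Σ (Fin n ↔ Fin n) (λ ord → ExcludesForbiddenPatterns G ord)
mainTheorem1 n G = mk⇔ (mobility⇒ordering G) (λ (ord , excludes) → ordering⇒mobility G ord excludes)
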